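{- Let $N$ be a 0,1-network and let $y_1,\dots,y_k$ be the minimal reactants of $N$. Suppose that for each $i=1,\dots,k$ there is a reaction $y_i\to y_i'$ of $N$ such that either its reactant vertex $u_i$ or its product vertex $v_i$ in $\mathcal H_N$ is almost balanced. Then $\mathcal I(N)$ is a monomial ideal, and in particular $\mathcal I(N)=\langle x^{y_1},\dots,x^{y_k}\rangle$.
   Context: A chemical reaction network $N=(\mathscr S,\mathscr C,\mathscr R)$ consists of a finite set of species $\mathscr S$, a finite set of complexes $\mathscr C\subseteq\mathbb Z_{\ge0}^{\mathscr S}$, and a finite set of reactions $\mathscr R$, each written $y\to y'$ with $y,y'\in\mathscr C$, $y\ne y'$; every complex occurs in some reaction, every species lies in the support of some complex, and there are no reactions of the form $\varnothing\to y$. Reactions are indexed, the $j$-th written $y_j\to y_j'$ with rate constant $\kappa_j$. $N$ is a 0,1-network if every complex lies in $\{0,1\}^{\mathscr S}$. For complexes, $y\mid y'$ means $y_s\le y'_s$ for all $s$. The minimal reactants of $N$ are the reactant complexes $y$ (complexes occurring as the source of some reaction) such that no other reactant complex $y''\neq y$ satisfies $y''\mid y$. $x^y=\prod_s x_s^{y_s}$. The steady-state polynomial of species $s$ is $\dot x_s=\sum_j\kappa_j x^{y_j}(y'_{j,s}-y_{j,s})\in\mathbb K(\kappa)[x]$, with the $\kappa_j$ indeterminates and $\mathbb K$ a field of characteristic zero; the steady-state ideal is $\mathcal I(N)=\langle\dot x_s: s\in\mathscr S\rangle$. The network hypergraph $\mathcal H_N$ has vertices $u_j,v_j$ for each reaction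 $j$ ($u_j$ represents the reactant $y_j$ of reaction $j$, $v_j$ its product $y_j'$; all these are distinct vertices). Hyperedges: for each species $s$, $E_s=\{u_j: s\in\mathrm{supp}(y_j)\}\cup\{v_j: s\in\mathrm{supp}(y_j')\}$; for each reaction $j$, $E_j=\{u_j,v_j\}$ if $y_j'\ne\varnothing$ and $E_j=\varnothing$ otherwise. A multiset $\mathscr E$ over the edges assigns nonnegative multiplicities; a 2-coloring $\mathscr E=\mathscr E_r\sqcup\mathscr E_b$ splits it into two submultisets whose multiplicities add up. $\deg_{\mathscr E_c}(w)$ is the number of edges of $\mathscr E_c$, with multiplicity, containing $w$. A vertex $w$ is almost balanced if there is some multiset and 2-coloring with $\deg_{\mathscr E_r}(w)=\deg_{\mathscr E_b}(w)+k$ for some positive integer $k$ and $\deg_{\mathscr E_r}(z)=\deg_{\mathscr E_b}(z)$ for every other vertex $z$. -}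

module Defs where

open import Level using (Level; _⊔_)
open import Algebra.Bundles using (CommutativeRing)
open import Data.Nat as ℕ using (ℕ; zero; suc; _≥_)
open import Data.Integer as ℤ using (ℤ; +_; -[1+_])
open import Data.Bool using (Bool; true; false)
open import Data.Fin using (Fin)
open import Data.Vec as V using (Vec; lookup; tabulate; replicate)
open import Data.Vec.Properties using (≡-dec)
open import Data.List as L using (List; []; _∷_; _++_; concatMap)
open import Data.Product using (Σ; ∃; ∃-syntax; _×_; _,_)
open import Data.Sum using (_⊎_; inj₁; inj₂)
open import Relation.Nullary using (¬_; yes; no)
open import Relation.Binary.PropositionalEquality using (_≡_; _≢_)
open import Data.Unit using (⊤)

natK : ∀ {c ℓ} (R : CommutativeRing c ℓ) → ℕ → CommutativeRing.Carrier R
natK R zero    = CommutativeRing.0# R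
natK R (suc n) = CommutativeRing._+_ R (CommutativeRing.1# R) (natK R n)

record CharZeroField (c ℓ : Level) : Set (Level.suc (c ⊔ ℓ)) where
  field
    cring : CommutativeRing c ℓ
  open CommutativeRing cring
  field
    1≉0      : ¬ (1# ≈ 0#)
    inverse  : ∀ x → ¬ (x ≈ 0#) → Σ Carrier λ y → (x * y) ≈ 1#
    charZero : ∀ n → ¬ (natK cring (suc n) ≈ 0#)

-- The complex set is the set of complexes
-- occurring in reactions (so "every complex occurs in a reaction" holds
-- by construction).

Complex : ℕ → Set
Complex n = Vec Bool n

zeroComplex : ∀ {n} → Complex n
zeroComplex = replicate _ false

record Network (n m : ℕ) : Set where
  field
    reactant : Fin m → Complex n
    product  : Fin m → Complex n
    nonTrivial : ∀ j → reactant j ≢ product j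
    noInflow   : ∀ j → reactant j ≢ zeroComplex
    covering   : ∀ s → ∃[ j ] (lookup (reactant j) s ≡ true ⊎ lookup (product j) s ≡ true)
    distinct   : ∀ i j → reactant i ≡ reactant j → product i ≡ product j → i ≡ j

_∣C_ : ∀ {n} → Complex n → Complex n → Set
y ∣C y' = ∀ s → lookup y s ≡ true → lookup y' s ≡ true

module _ {n m : ℕ} (N : Network n m) where
  open Network N

  IsReactant : Complex n → Set
  IsReactant y = ∃[ j ] reactant j ≡ y

  IsMinimalReactant : Complex n → Set
  IsMinimalReactant y = IsReactant y × (∀ j → reactant j ∣C y → reactant j ≡ y)

  -- The network hypergraph H_N.
  -- Vertices: u j  (reactant of reaction j),  v j  (product of reaction j).
  data Vertex : Set where
    u v : Fin m → Vertex

  data Edge : Set where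
    speciesEdge  : Fin n → Edge
    reactionEdge : Fin m → Edge

  b2n : Bool → ℕ
  b2n true  = 1
  b2n false = 0

  isNonZero : Complex n → Bool
  isNonZero y = V.foldr _ Data.Bool._∨_ false y

  inc : Vertex → Edge → ℕ
  inc (u j) (speciesEdge s)  = b2n (lookup (reactant j) s)
  inc (v j) (speciesEdge s)  = b2n (lookup (product j) s)
  inc (u j) (reactionEdge i) with j Data.Fin.≟ i
  ... | yes _ = b2n (isNonZero (product i))
  ... | no  _ = 0
  inc (v j) (reactionEdge i) with j Data.Fin.≟ i
  ... | yes _ = b2n (isNonZero (product i))
  ... | no  _ = 0

  ∑ : ∀ {k} → (Fin k → ℕ) → ℕ
  ∑ f = V.sum (tabulate f)

  Multiset : Set
  Multiset = Edge → ℕ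

  deg : Multiset → Vertex → ℕ
  deg E w = ∑ (λ s → E (speciesEdge s) ℕ.* inc w (speciesEdge s))
            ℕ.+ ∑ (λ j → E (reactionEdge j) ℕ.* inc w (reactionEdge j))

  AlmostBalanced : Vertex → Set
  AlmostBalanced w =
    Σ Multiset λ Er → Σ Multiset λ Eb → Σ ℕ λ k →
      (k ≥ 1) × (deg Er w ≡ deg Eb w ℕ.+ k) ×
      (∀ z → z ≢ w → deg Er z ≡ deg Eb z)

-- Polynomials K[κ, x] with κ = (κ_j)_{j : Fin m}, x = (x_s)_{s : Fin n}:
-- finite lists of terms  c · κ^a x^b, compared coefficientwise.

module Poly {c ℓ : Level} (F : CharZeroField c ℓ) (n m : ℕ) where
  open CharZeroField F
  open CommutativeRing cring

  record Term : Set c where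
    constructor term
    field
      coef : Carrier
      κexp : Vec ℕ m
      xexp : Vec ℕ n

  Pol : Set c
  Pol = List Term

  coeff : Pol → Vec ℕ m → Vec ℕ n → Carrier
  coeff [] a b = 0#
  coeff (term c a' b' ∷ p) a b with ≡-dec ℕ._≟_ a a' | ≡-dec ℕ._≟_ b b'
  ... | yes _ | yes _ = c + coeff p a b
  ... | _     | _     = coeff p a b

  _≈P_ : Pol → Pol → Set ℓ
  p ≈P q = ∀ a b → coeff p a b ≈ coeff q a b
  infix 4 _≈P_

  0P : Pol
  0P = []

  1P : Pol
  1P = term 1# (replicate _ 0) (replicate _ 0) ∷ []

  _+P_ : Pol → Pol → Pol
  p +P q = p ++ q

  mulT : Term → Term → Term
  mulT (term c a b) (term c' a' b') = term (c * c') (V.zipWith ℕ._+_ a a') (V.zipWith ℕ._+_ b b')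

  _*P_ : Pol → Pol → Pol
  p *P q = concatMap (λ t → L.map (mulT t) q) p

  ∑P : ∀ {k} → (Fin k → Pol) → Pol
  ∑P f = V.foldr _ _+P_ 0P (tabulate f)

  intK : ℤ → Carrier
  intK (+ k)     = natK cring k
  intK -[1+ k ]  = - natK cring (suc k)

  boolExp : Vec Bool n → Vec ℕ n
  boolExp y = V.map (λ { true → 1 ; false → 0 }) y

  xMon : Vec Bool n → Pol
  xMon y = term 1# (replicate _ 0) (boolExp y) ∷ []

  unitExp : Fin m → Vec ℕ m
  unitExp j = tabulate (λ i → b i)
    where
    b : Fin m → ℕ
    b i with i Data.Fin.≟ j
    ... | yes _ = 1
    ... | no  _ = 0

  -- K(κ)[x] as the localisation of K[κ,x] at the nonzero elements of K[κ]:
  -- fractions a / d with a ∈ K[κ,x], 0 ≠ d ∈ K[κ].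

  InKκ : Pol → Set ℓ
  InKκ d = ∀ a b → b ≢ replicate _ 0 → coeff d a b ≈ 0#

  Frac : Set c
  Frac = Pol × Pol

  ValidFrac : Frac → Set ℓ
  ValidFrac (a , d) = InKκ d × ¬ (d ≈P 0P)

  _≈F_ : Frac → Frac → Set ℓ
  (a , d) ≈F (a' , d') = (a *P d') ≈P (a' *P d)

  _+F_ : Frac → Frac → Frac
  (a , d) +F (a' , d') = ((a *P d') +P (a' *P d)) , (d *P d')

  _*F_ : Frac → Frac → Frac
  (a , d) *F (a' , d') = (a *P a') , (d *P d')

  embed : Pol → Frac
  embed p = p , 1P

  ∑F : ∀ {k} → (Fin k → Frac) → Frac
  ∑F f = V.foldr _ _+F_ (0P , 1P) (tabulate f)

  InIdeal : ∀ {k} {p} → (Fin k → Pol) → (Fin k → Set p) → Pol → Set (c ⊔ ℓ ⊔ p)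
  InIdeal g Allowed f =
    Σ (Fin _ → Frac) λ h →
      (∀ i → ValidFrac (h i)) ×
      (∀ i → ¬ Allowed i → h i ≈F embed 0P) ×
      (embed f ≈F ∑F (λ i → h i *F embed (g i)))

  module _ (N : Network n m) where
    open Network N

    stoich : Fin m → Fin n → ℤ
    stoich j s = + b2n N (lookup (product j) s) ℤ.- + b2n N (lookup (reactant j) s)

    xdot : Fin n → Pol
    xdot s = ∑P (λ j → term (intK (stoich j s)) (unitExp j) (boolExp (reactant j)) ∷ [])

-- Each term κ_l x^(y_l) of ẋ_s is divisible by x^(y_j) for some minimal reactant y_j
-- dividing y_l; grouping the terms of ẋ_s by such a choice of j writes ẋ_s as a
-- combination of the monomials of the minimal reactants.
--
-- Conversely, let a 2-colouring witness that u_i or v_i is almost balanced, and weight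
-- species s by λ_s = r_s − b_s, the red minus blue multiplicity of E_s.  Since u_l and
-- v_l lie in the same reaction edges, the balance at u_l and v_l (l ≠ i) forces
-- Σ_s λ_s (y'_{l,s} − y_{l,s}) = 0, while the excess k at u_i or v_i makes this sum ∓k ≠ 0
-- for l = i (characteristic zero).  Hence Σ_s λ_s ẋ_s = ∓k κ_i x^(y_i), and dividing
-- by ∓k κ_i in K(κ)[x] puts x^(y_i) into 𝓘(N).

module Submission where

open import Algebra.Bundles using (CommutativeRing)
open import Data.Nat as ℕ using (ℕ; zero; suc; _∸_; _<_; _≤_; z≤n; s≤s)
import Data.Nat.Properties as ℕₚ
open import Data.Fin as Fin using (Fin)
open import Data.Fin.Properties using (suc-injective)
open import Data.Vec as V using (Vec; lookup; tabulate)
import Data.Vec.Properties as Vₚ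
open import Data.Product using (∃-syntax; _×_; _,_; proj₁; proj₂)
open import Data.Sum using (_⊎_)
open import Data.Unit using (⊤)
open import Relation.Nullary using (¬_; yes; no)
open import Function using (_∘_)
open import Relation.Binary.PropositionalEquality as ≡ using (_≡_; _≢_)

open import Defs

module RingFacts {c ℓ} (R : CommutativeRing c ℓ) where
  open CommutativeRing R
  open import Relation.Binary.Reasoning.Setoid setoid
  open import Algebra.Properties.Ring ring using (-0#≈0#; -‿+-comm; ⁻¹-anti-homo‿-; x[y-z]≈xy-xz; [y-z]x≈yx-zx)
  open import Algebra.Definitions.RawMonoid +-rawMonoid using () renaming (_×_ to _×ₘ_)
  open import Algebra.Properties.CommutativeSemigroup +-commutativeSemigroup using (interchange)
  open import Algebra.Properties.Monoid.Mult +-monoid using (×-homo-+)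
  open import Algebra.Properties.Semiring.Mult semiring using (×1-homo-*)
  open import Algebra.Properties.Semiring.Sum semiring public
    using (sum; sum-cong-≋; sum-replicate-zero; ∑-distrib-+; ∑-comm; *-distribˡ-sum; *-distribʳ-sum)

  sum-zero : ∀ {k} (f : Fin k → Carrier) → (∀ i → f i ≈ 0#) → sum f ≈ 0#
  sum-zero {k} f f≈0 = trans (sum-cong-≋ f≈0) (sum-replicate-zero k)

  sum-single : ∀ {k} (f : Fin k → Carrier) i → (∀ j → j ≢ i → f j ≈ 0#) → sum f ≈ f i
  sum-single {suc k} f Fin.zero    f≈0 =
    trans (+-congˡ (sum-zero _ (λ j → f≈0 (Fin.suc j) λ ()))) (+-identityʳ _)
  sum-single {suc k} f (Fin.suc i) f≈0 =
    trans (+-cong (f≈0 Fin.zero λ ()) (sum-single (λ j → f (Fin.suc j)) i (λ j j≢i → f≈0 (Fin.suc j) (j≢i ∘ suc-injective))))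
          (+-identityˡ _)

  -‿cong₂ : ∀ {x x' y y'} → x ≈ x' → y ≈ y' → x - y ≈ x' - y'
  -‿cong₂ x≈x' y≈y' = +-cong x≈x' (-‿cong y≈y')

  sum-neg : ∀ {k} (f : Fin k → Carrier) → sum (λ i → - f i) ≈ - sum f
  sum-neg {zero}  f = sym -0#≈0#
  sum-neg {suc k} f = trans (+-congˡ (sum-neg (λ i → f (Fin.suc i)))) (-‿+-comm _ _)

  ∑-distrib-‿ : ∀ {k} (f g : Fin k → Carrier) → sum (λ i → f i - g i) ≈ sum f - sum g
  ∑-distrib-‿ f g = trans (∑-distrib-+ f (λ i → - g i)) (+-congˡ (sum-neg g))

  -‿interchange : ∀ a b c d → (a + b) - (c + d) ≈ (a - c) + (b - d)
  -‿interchange a b c d = trans (+-congˡ (sym (-‿+-comm c d))) (interchange a b (- c) (- d))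

  diff-swap : ∀ {x y z w} → x + z ≈ y + w → x - y ≈ w - z
  diff-swap {x} {y} {z} {w} x+z≈y+w = begin
    x - y                 ≈⟨ sym (+-identityʳ _) ⟩
    (x - y) + 0#          ≈⟨ +-congˡ (sym (-‿inverseʳ z)) ⟩
    (x - y) + (z - z)     ≈⟨ sym (-‿interchange x z y z) ⟩
    (x + z) - (y + z)     ≈⟨ +-congʳ x+z≈y+w ⟩
    (y + w) - (y + z)     ≈⟨ -‿interchange y w y z ⟩
    (y - y) + (w - z)     ≈⟨ +-congʳ (-‿inverseʳ y) ⟩
    0# + (w - z)          ≈⟨ +-identityˡ _ ⟩
    w - z                 ∎

  expand-diff-* : ∀ r b p q → (r - b) * (p - q) ≈ (r * p + b * q) - (r * q + b * p)
  expand-diff-* r b p q = begin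
    (r - b) * (p - q)                     ≈⟨ [y-z]x≈yx-zx (p - q) r b ⟩
    r * (p - q) - b * (p - q)             ≈⟨ -‿cong₂ (x[y-z]≈xy-xz r p q) (x[y-z]≈xy-xz b p q) ⟩
    (r * p - r * q) - (b * p - b * q)     ≈⟨ +-congˡ (⁻¹-anti-homo‿- (b * p) (b * q)) ⟩
    (r * p - r * q) + (b * q - b * p)     ≈⟨ sym (-‿interchange (r * p) (b * q) (r * q) (b * p)) ⟩
    (r * p + b * q) - (r * q + b * p)     ∎

  natK≡× : ∀ k → natK R k ≡ k ×ₘ 1#
  natK≡× zero    = ≡.refl
  natK≡× (suc k) = ≡.cong (1# +_) (natK≡× k)

  natK-+ : ∀ a b → natK R (a ℕ.+ b) ≈ natK R a + natK R b
  natK-+ a b rewrite natK≡× (a ℕ.+ b) | natK≡× a | natK≡× b = ×-homo-+ 1# a b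

  natK-* : ∀ a b → natK R (a ℕ.* b) ≈ natK R a * natK R b
  natK-* a b rewrite natK≡× (a ℕ.* b) | natK≡× a | natK≡× b = ×1-homo-* a b

  natK-sum : ∀ {k} (f : Fin k → ℕ) → natK R (V.sum (tabulate f)) ≈ sum (λ i → natK R (f i))
  natK-sum {zero}  f = refl
  natK-sum {suc k} f = trans (natK-+ (f Fin.zero) _) (+-congˡ (natK-sum (λ i → f (Fin.suc i))))

module ExponentVectors where
  open import Data.Vec using ([]; _∷_)
  open import Data.Maybe using (Maybe; just; nothing)
  import Data.Maybe as Maybe
  open import Data.Maybe.Properties using (just-injective)
  open import Function using (_⇔_; mk⇔)
  open import Data.Empty using (⊥-elim)

  infixl 6 _+ᵛ_ _∸?_

  _+ᵛ_ : ∀ {k} → Vec ℕ k → Vec ℕ k → Vec ℕ k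
  _+ᵛ_ = V.zipWith ℕ._+_

  _∸?_ : ∀ {k} → Vec ℕ k → Vec ℕ k → Maybe (Vec ℕ k)
  []       ∸? []       = just []
  (x ∷ xs) ∸? (y ∷ ys) with y ℕ.≤? x
  ... | yes _ = Maybe.map (x ∸ y ∷_) (xs ∸? ys)
  ... | no  _ = nothing

  +ᵛ-∸? : ∀ {k} (a x : Vec ℕ k) → (a +ᵛ x) ∸? a ≡ just x
  +ᵛ-∸? []       []       = ≡.refl
  +ᵛ-∸? (a ∷ as) (x ∷ xs) with a ℕ.≤? a ℕ.+ x
  ... | yes _   rewrite +ᵛ-∸? as xs = ≡.cong (λ d → just (d ∷ xs)) (ℕₚ.m+n∸m≡n a x)
  ... | no  a≰a+x = ⊥-elim (a≰a+x (ℕₚ.m≤m+n a x))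

  ∸?-sound : ∀ {k} (a a' x : Vec ℕ k) → a ∸? a' ≡ just x → a ≡ a' +ᵛ x
  ∸?-sound []       []         []       _  = ≡.refl
  ∸?-sound (x ∷ xs) (y ∷ ys) _ eq with y ℕ.≤? x
  ... | yes y≤x with xs ∸? ys in eq'
  ...   | just r with eq
  ...     | ≡.refl = ≡.cong₂ _∷_ (≡.sym (ℕₚ.m+[n∸m]≡n y≤x)) (∸?-sound xs ys r eq')

  ∸?-just : ∀ {k} {a a' a₀ : Vec ℕ k} → a ∸? a' ≡ just a₀ → ∀ x → a ≡ a' +ᵛ x ⇔ a₀ ≡ x
  ∸?-just {a = a} {a'} {a₀} eq x = mk⇔
    (λ { ≡.refl → just-injective (≡.trans (≡.sym eq) (+ᵛ-∸? a' x)) })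
    (λ { ≡.refl → ∸?-sound a a' a₀ eq })

  ∸?-nothing : ∀ {k} {a a' : Vec ℕ k} → a ∸? a' ≡ nothing → ∀ x → a ≢ a' +ᵛ x
  ∸?-nothing {a' = a'} eq x ≡.refl with ≡.trans (≡.sym eq) (+ᵛ-∸? a' x)
  ... | ()

  ∸?-zero : ∀ {k} (a : Vec ℕ k) → a ∸? V.replicate k 0 ≡ just a
  ∸?-zero a = ≡.subst (λ b → b ∸? V.replicate _ 0 ≡ just a)
                      (Vₚ.zipWith-identityˡ ℕₚ.+-identityˡ a) (+ᵛ-∸? (V.replicate _ 0) a)

module Polynomials {c ℓ} (F : CharZeroField c ℓ) (n m : ℕ) where
  open CharZeroField F
  open CommutativeRing cring
  open Poly F n m
  open RingFacts cring
  open ExponentVectors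
  open import Data.Maybe using (just; nothing)
  open import Data.Bool using (if_then_else_)
  open import Relation.Nullary using (does)
  open import Data.List as L using ([]; _∷_; _++_)
  import Data.List.Properties as Lₚ
  open import Data.Empty using (⊥-elim)
  open import Function using (id; Equivalence; _⇔_; mk⇔)
  open import Relation.Binary.Structures using (IsEquivalence)
  open import Relation.Binary.Bundles using (Setoid)
  open import Data.Product.Function.NonDependent.Propositional using (_×-⇔_)
  open import Relation.Nullary.Decidable using (_×-dec_)
  open import Data.Vec.Properties using (≡-dec)
  open import Relation.Binary.Reasoning.Setoid setoid

  termCoeff : Term → Vec ℕ m → Vec ℕ n → Carrier
  termCoeff (term c a' b') a b with ≡-dec ℕ._≟_ a a' | ≡-dec ℕ._≟_ b b'
  ... | yes _ | yes _ = c
  ... | _     | _     = 0#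

  coeff-∷ : ∀ t p a b → coeff (t ∷ p) a b ≈ termCoeff t a b + coeff p a b
  coeff-∷ (term c a' b') p a b with ≡-dec ℕ._≟_ a a' | ≡-dec ℕ._≟_ b b'
  ... | yes _ | yes _ = refl
  ... | yes _ | no  _ = sym (+-identityˡ _)
  ... | no  _ | _     = sym (+-identityˡ _)

  termCoeff-hit : ∀ c a b → termCoeff (term c a b) a b ≈ c
  termCoeff-hit c a b with ≡-dec ℕ._≟_ a a | ≡-dec ℕ._≟_ b b
  ... | yes _   | yes _   = refl
  ... | yes _   | no  b≢b = ⊥-elim (b≢b ≡.refl)
  ... | no  a≢a | _       = ⊥-elim (a≢a ≡.refl)

  termCoeff-miss : ∀ c a' b' a b → ¬ (a ≡ a' × b ≡ b') → termCoeff (term c a' b') a b ≈ 0#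
  termCoeff-miss c a' b' a b miss with ≡-dec ℕ._≟_ a a' | ≡-dec ℕ._≟_ b b'
  ... | yes a≡a' | yes b≡b' = ⊥-elim (miss (a≡a' , b≡b'))
  ... | yes _    | no  _    = refl
  ... | no  _    | _        = refl

  termCoeff-cong : ∀ {c c' a₁ b₁ a₂ b₂ a b a' b'} → c ≈ c' →
                   (a ≡ a₁ × b ≡ b₁) ⇔ (a' ≡ a₂ × b' ≡ b₂) →
                   termCoeff (term c a₁ b₁) a b ≈ termCoeff (term c' a₂ b₂) a' b'
  termCoeff-cong {c} {c'} {a₁} {b₁} {a₂} {b₂} {a} {b} {a'} {b'} c≈c' match
    with ≡-dec ℕ._≟_ a a₁ ×-dec ≡-dec ℕ._≟_ b b₁
  ... | no miss = trans (termCoeff-miss c a₁ b₁ a b miss)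
                        (sym (termCoeff-miss c' a₂ b₂ a' b' (miss ∘ Equivalence.from match)))
  ... | yes hit@(≡.refl , ≡.refl) with Equivalence.to match hit
  ...   | ≡.refl , ≡.refl = trans (termCoeff-hit c a b) (trans c≈c' (sym (termCoeff-hit c' a' b')))

  termCoeff-cong-≡ : ∀ {c c' a₁ b₁ a₂ b₂} → c ≈ c' → a₁ ≡ a₂ → b₁ ≡ b₂ →
                     ∀ a b → termCoeff (term c a₁ b₁) a b ≈ termCoeff (term c' a₂ b₂) a b
  termCoeff-cong-≡ c≈c' ≡.refl ≡.refl a b = termCoeff-cong {a = a} {b} {a} {b} c≈c' (mk⇔ id id)

  termCoeff-*ˡ : ∀ x c a' b' a b → termCoeff (term (x * c) a' b') a b ≈ x * termCoeff (term c a' b') a b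
  termCoeff-*ˡ x c a' b' a b with ≡-dec ℕ._≟_ a a' | ≡-dec ℕ._≟_ b b'
  ... | yes _ | yes _ = refl
  ... | yes _ | no  _ = sym (zeroʳ x)
  ... | no  _ | _     = sym (zeroʳ x)

  termCoeff-scale : ∀ x a' b' a b → termCoeff (term x a' b') a b ≈ x * termCoeff (term 1# a' b') a b
  termCoeff-scale x a' b' a b =
    trans (termCoeff-cong-≡ (sym (*-identityʳ x)) ≡.refl ≡.refl a b) (termCoeff-*ˡ x 1# a' b' a b)

  -- shift t f is the coefficient function of t · p when f is that of p
  shift : Term → (Vec ℕ m → Vec ℕ n → Carrier) → Vec ℕ m → Vec ℕ n → Carrier
  shift (term c a' b') f a b with a ∸? a' | b ∸? b'
  ... | just a₀ | just b₀ = c * f a₀ b₀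
  ... | _       | _       = 0#

  shift-cong : ∀ t {f g} → (∀ a b → f a b ≈ g a b) → ∀ a b → shift t f a b ≈ shift t g a b
  shift-cong (term c a' b') f≈g a b with a ∸? a' | b ∸? b'
  ... | just a₀ | just b₀ = *-congˡ (f≈g a₀ b₀)
  ... | just _  | nothing = refl
  ... | nothing | _       = refl

  shift-+ : ∀ t f g a b → shift t (λ a b → f a b + g a b) a b ≈ shift t f a b + shift t g a b
  shift-+ (term c a' b') f g a b with a ∸? a' | b ∸? b'
  ... | just a₀ | just b₀ = distribˡ c _ _
  ... | just _  | nothing = sym (+-identityˡ 0#)
  ... | nothing | _       = sym (+-identityˡ 0#)

  shift-0 : ∀ t a b → shift t (λ _ _ → 0#) a b ≈ 0#
  shift-0 (term c a' b') a b with a ∸? a' | b ∸? b'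
  ... | just _  | just _  = zeroʳ c
  ... | just _  | nothing = refl
  ... | nothing | _       = refl

  shift-constant : ∀ x f a b → shift (term x (V.replicate m 0) (V.replicate n 0)) f a b ≈ x * f a b
  shift-constant x f a b rewrite ∸?-zero a | ∸?-zero b = refl

  termCoeff-mulT : ∀ t t' a b → termCoeff (mulT t t') a b ≈ shift t (termCoeff t') a b
  termCoeff-mulT (term c a' b') (term c'' a'' b'') a b with a ∸? a' in a∸a' | b ∸? b' in b∸b'
  ... | just a₀ | just b₀ =
    trans (termCoeff-cong {a = a} {b} {a₀} {b₀} refl (∸?-just a∸a' a'' ×-⇔ ∸?-just b∸b' b'')) (termCoeff-*ˡ c c'' a'' b'' a₀ b₀)
  ... | just _  | nothing = termCoeff-miss _ _ _ a b (∸?-nothing b∸b' b'' ∘ proj₂)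
  ... | nothing | _       = termCoeff-miss _ _ _ a b (∸?-nothing a∸a' a'' ∘ proj₁)

  Σₗ : (Term → Carrier) → Pol → Carrier
  Σₗ f []      = 0#
  Σₗ f (t ∷ p) = f t + Σₗ f p

  Σₗ-cong : ∀ {f g} p → (∀ t → f t ≈ g t) → Σₗ f p ≈ Σₗ g p
  Σₗ-cong []      f≈g = refl
  Σₗ-cong (t ∷ p) f≈g = +-cong (f≈g t) (Σₗ-cong p f≈g)

  Σₗ-++ : ∀ f p q → Σₗ f (p ++ q) ≈ Σₗ f p + Σₗ f q
  Σₗ-++ f []      q = sym (+-identityˡ _)
  Σₗ-++ f (t ∷ p) q = trans (+-congˡ (Σₗ-++ f p q)) (sym (+-assoc _ _ _))

  Σₗ-map : ∀ f g q → Σₗ f (L.map g q) ≈ Σₗ (f ∘ g) q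
  Σₗ-map f g []      = refl
  Σₗ-map f g (t ∷ q) = +-congˡ (Σₗ-map f g q)

  Σₗ-zero : ∀ f p → (∀ t → f t ≈ 0#) → Σₗ f p ≈ 0#
  Σₗ-zero f []      f≈0 = refl
  Σₗ-zero f (t ∷ p) f≈0 = trans (+-cong (f≈0 t) (Σₗ-zero f p f≈0)) (+-identityˡ 0#)

  Σₗ-+ : ∀ f g p → Σₗ (λ t → f t + g t) p ≈ Σₗ f p + Σₗ g p
  Σₗ-+ f g []      = sym (+-identityˡ 0#)
  Σₗ-+ f g (t ∷ p) = trans (+-congˡ (Σₗ-+ f g p)) (interchange _ _ _ _)
    where open import Algebra.Properties.CommutativeSemigroup +-commutativeSemigroup using (interchange)

  Σₗ-comm : ∀ (f : Term → Term → Carrier) p q →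
            Σₗ (λ t → Σₗ (f t) q) p ≈ Σₗ (λ t' → Σₗ (λ t → f t t') p) q
  Σₗ-comm f []      q = sym (Σₗ-zero _ q (λ _ → refl))
  Σₗ-comm f (t ∷ p) q = trans (+-congˡ (Σₗ-comm f p q)) (sym (Σₗ-+ _ _ q))

  Σₗ-*P : ∀ f p q → Σₗ f (p *P q) ≈ Σₗ (λ t → Σₗ (f ∘ mulT t) q) p
  Σₗ-*P f []      q = refl
  Σₗ-*P f (t ∷ p) q = trans (Σₗ-++ f (L.map (mulT t) q) (p *P q)) (+-cong (Σₗ-map f (mulT t) q) (Σₗ-*P f p q))

  coeff-Σₗ : ∀ p a b → coeff p a b ≈ Σₗ (λ t → termCoeff t a b) p
  coeff-Σₗ []      a b = refl
  coeff-Σₗ (t ∷ p) a b = trans (coeff-∷ t p a b) (+-congˡ (coeff-Σₗ p a b))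

  coeff-++ : ∀ p q a b → coeff (p ++ q) a b ≈ coeff p a b + coeff q a b
  coeff-++ p q a b = begin
    coeff (p ++ q) a b                   ≈⟨ coeff-Σₗ (p ++ q) a b ⟩
    Σₗ (λ t → termCoeff t a b) (p ++ q)  ≈⟨ Σₗ-++ _ p q ⟩
    Σₗ _ p + Σₗ _ q                      ≈⟨ sym (+-cong (coeff-Σₗ p a b) (coeff-Σₗ q a b)) ⟩
    coeff p a b + coeff q a b            ∎

  coeff-*P : ∀ p q a b → coeff (p *P q) a b ≈ Σₗ (λ t → Σₗ (λ t' → termCoeff (mulT t t') a b) q) p
  coeff-*P p q a b = trans (coeff-Σₗ (p *P q) a b) (Σₗ-*P _ p q)

  coeff-map-mulT : ∀ t q a b → coeff (L.map (mulT t) q) a b ≈ shift t (coeff q) a b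
  coeff-map-mulT t []       a b = sym (shift-0 t a b)
  coeff-map-mulT t (t' ∷ q) a b = begin
    coeff (mulT t t' ∷ L.map (mulT t) q) a b                ≈⟨ coeff-∷ _ _ a b ⟩
    termCoeff (mulT t t') a b + coeff (L.map (mulT t) q) a b ≈⟨ +-cong (termCoeff-mulT t t' a b) (coeff-map-mulT t q a b) ⟩
    shift t (termCoeff t') a b + shift t (coeff q) a b       ≈⟨ sym (shift-+ t _ _ a b) ⟩
    shift t (λ a b → termCoeff t' a b + coeff q a b) a b     ≈⟨ shift-cong t (λ a b → sym (coeff-∷ t' q a b)) a b ⟩
    shift t (coeff (t' ∷ q)) a b                            ∎

  termCoeff-mulT-comm : ∀ t t' a b → termCoeff (mulT t t') a b ≈ termCoeff (mulT t' t) a b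
  termCoeff-mulT-comm (term c a₁ b₁) (term c' a₂ b₂) =
    termCoeff-cong-≡ (*-comm c c') (Vₚ.zipWith-comm ℕₚ.+-comm a₁ a₂) (Vₚ.zipWith-comm ℕₚ.+-comm b₁ b₂)

  termCoeff-mulT-assoc : ∀ t t' t'' a b → termCoeff (mulT (mulT t t') t'') a b ≈ termCoeff (mulT t (mulT t' t'')) a b
  termCoeff-mulT-assoc (term c a₁ b₁) (term c' a₂ b₂) (term c'' a₃ b₃) =
    termCoeff-cong-≡ (*-assoc c c' c'') (Vₚ.zipWith-assoc ℕₚ.+-assoc a₁ a₂ a₃) (Vₚ.zipWith-assoc ℕₚ.+-assoc b₁ b₂ b₃)

  ≈P-isEquivalence : IsEquivalence _≈P_
  ≈P-isEquivalence = record
    { refl  = λ _ _ → refl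
    ; sym   = λ p≈q a b → sym (p≈q a b)
    ; trans = λ p≈q q≈r a b → trans (p≈q a b) (q≈r a b)
    }

  ≈P-setoid : Setoid c ℓ
  ≈P-setoid = record { isEquivalence = ≈P-isEquivalence }

  +P-cong : ∀ {p p' q q'} → p ≈P p' → q ≈P q' → p +P q ≈P p' +P q'
  +P-cong {p} {p'} {q} {q'} p≈p' q≈q' a b =
    trans (coeff-++ p q a b) (trans (+-cong (p≈p' a b) (q≈q' a b)) (sym (coeff-++ p' q' a b)))

  *P-congˡ : ∀ p {q q'} → q ≈P q' → p *P q ≈P p *P q'
  *P-congˡ []      q≈q' a b = refl
  *P-congˡ (t ∷ p) {q} {q'} q≈q' a b = begin
    coeff (L.map (mulT t) q ++ p *P q) a b              ≈⟨ coeff-++ (L.map (mulT t) q) (p *P q) a b ⟩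
    coeff (L.map (mulT t) q) a b + coeff (p *P q) a b   ≈⟨ +-cong (coeff-map-mulT t q a b) (*P-congˡ p q≈q' a b) ⟩
    shift t (coeff q) a b + coeff (p *P q') a b         ≈⟨ +-congʳ (shift-cong t q≈q' a b) ⟩
    shift t (coeff q') a b + coeff (p *P q') a b        ≈⟨ +-congʳ (sym (coeff-map-mulT t q' a b)) ⟩
    coeff (L.map (mulT t) q') a b + coeff (p *P q') a b ≈⟨ sym (coeff-++ (L.map (mulT t) q') (p *P q') a b) ⟩
    coeff (L.map (mulT t) q' ++ p *P q') a b            ∎

  *P-comm : ∀ p q → p *P q ≈P q *P p
  *P-comm p q a b = begin
    coeff (p *P q) a b                                       ≈⟨ coeff-*P p q a b ⟩
    Σₗ (λ t → Σₗ (λ t' → termCoeff (mulT t t') a b) q) p     ≈⟨ Σₗ-comm _ p q ⟩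
    Σₗ (λ t' → Σₗ (λ t → termCoeff (mulT t t') a b) p) q     ≈⟨ Σₗ-cong q (λ t' → Σₗ-cong p (λ t → termCoeff-mulT-comm t t' a b)) ⟩
    Σₗ (λ t' → Σₗ (λ t → termCoeff (mulT t' t) a b) p) q     ≈⟨ sym (coeff-*P q p a b) ⟩
    coeff (q *P p) a b                                       ∎

  *P-assoc : ∀ p q r → (p *P q) *P r ≈P p *P (q *P r)
  *P-assoc p q r a b = begin
    coeff ((p *P q) *P r) a b
      ≈⟨ coeff-*P (p *P q) r a b ⟩
    Σₗ (λ s → Σₗ (λ t'' → termCoeff (mulT s t'') a b) r) (p *P q)
      ≈⟨ Σₗ-*P _ p q ⟩
    Σₗ (λ t → Σₗ (λ t' → Σₗ (λ t'' → termCoeff (mulT (mulT t t') t'') a b) r) q) p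
      ≈⟨ Σₗ-cong p (λ t → Σₗ-cong q (λ t' → Σₗ-cong r (λ t'' → termCoeff-mulT-assoc t t' t'' a b))) ⟩
    Σₗ (λ t → Σₗ (λ t' → Σₗ (λ t'' → termCoeff (mulT t (mulT t' t'')) a b) r) q) p
      ≈⟨ Σₗ-cong p (λ t → sym (Σₗ-*P (λ s → termCoeff (mulT t s) a b) q r)) ⟩
    Σₗ (λ t → Σₗ (λ s → termCoeff (mulT t s) a b) (q *P r)) p
      ≈⟨ sym (coeff-*P p (q *P r) a b) ⟩
    coeff (p *P (q *P r)) a b ∎

  *P-distribʳ : ∀ p q r → (p +P q) *P r ≈P (p *P r) +P (q *P r)
  *P-distribʳ p q r a b = reflexive (≡.cong (λ s → coeff s a b) (Lₚ.concatMap-++ (λ t → L.map (mulT t) r) p q))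

  κMonomial : Carrier → Vec ℕ m → Pol
  κMonomial x a₀ = term x a₀ (V.replicate n 0) ∷ []

  coeff-singleton : ∀ t a b → coeff (t ∷ []) a b ≈ termCoeff t a b
  coeff-singleton t a b = trans (coeff-∷ t [] a b) (+-identityʳ _)

  constant-*P : ∀ x q a b → coeff (κMonomial x (V.replicate m 0) *P q) a b ≈ x * coeff q a b
  constant-*P x q a b = begin
    coeff (L.map (mulT t) q ++ []) a b     ≈⟨ coeff-++ (L.map (mulT t) q) [] a b ⟩
    coeff (L.map (mulT t) q) a b + 0#      ≈⟨ +-identityʳ _ ⟩
    coeff (L.map (mulT t) q) a b           ≈⟨ coeff-map-mulT t q a b ⟩
    shift t (coeff q) a b                  ≈⟨ shift-constant x (coeff q) a b ⟩
    x * coeff q a b                        ∎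
    where t = term x (V.replicate m 0) (V.replicate n 0)

  *P-identityˡ : ∀ p → 1P *P p ≈P p
  *P-identityˡ p a b = trans (constant-*P 1# p a b) (*-identityˡ _)

  coeff-∑P : ∀ {k} (f : Fin k → Pol) a b → coeff (∑P f) a b ≈ sum (λ i → coeff (f i) a b)
  coeff-∑P {zero}  f a b = refl
  coeff-∑P {suc k} f a b = trans (coeff-++ (f Fin.zero) _ a b) (+-congˡ (coeff-∑P (λ i → f (Fin.suc i)) a b))

  coeff-∑P-*P : ∀ {k} (f : Fin k → Pol) r a b → coeff (∑P f *P r) a b ≈ sum (λ i → coeff (f i *P r) a b)
  coeff-∑P-*P {zero}  f r a b = refl
  coeff-∑P-*P {suc k} f r a b = begin
    coeff ((f Fin.zero +P ∑P (f ∘ Fin.suc)) *P r) a b                 ≈⟨ *P-distribʳ (f Fin.zero) _ r a b ⟩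
    coeff ((f Fin.zero *P r) +P (∑P (f ∘ Fin.suc) *P r)) a b           ≈⟨ coeff-++ (f Fin.zero *P r) _ a b ⟩
    coeff (f Fin.zero *P r) a b + coeff (∑P (f ∘ Fin.suc) *P r) a b   ≈⟨ +-congˡ (coeff-∑P-*P (f ∘ Fin.suc) r a b) ⟩
    sum (λ i → coeff (f i *P r) a b)                                  ∎

  ∑P-cong : ∀ {k} {f g : Fin k → Pol} → (∀ i → f i ≈P g i) → ∑P f ≈P ∑P g
  ∑P-cong {f = f} {g} f≈g a b =
    trans (coeff-∑P f a b) (trans (sum-cong-≋ (λ i → f≈g i a b)) (sym (coeff-∑P g a b)))

  fibreSum : ∀ {k k'} → (Fin k → Fin k') → (Fin k → Pol) → Fin k' → Pol
  fibreSum μ h j = ∑P (λ l → if does (μ l Fin.≟ j) then h l else 0P)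

  fibreSum-outside-image : ∀ {k k'} (μ : Fin k → Fin k') h j → (∀ l → μ l ≢ j) → fibreSum μ h j ≈P 0P
  fibreSum-outside-image μ h j outside a b =
    trans (coeff-∑P (λ l → if does (μ l Fin.≟ j) then h l else 0P) a b) (sum-zero _ vanishes)
    where
    vanishes : ∀ l → coeff (if does (μ l Fin.≟ j) then h l else 0P) a b ≈ 0#
    vanishes l with μ l Fin.≟ j
    ... | yes μl≡j = ⊥-elim (outside l μl≡j)
    ... | no  _    = refl

  ∑P-fibreSum : ∀ {k k'} (μ : Fin k → Fin k') h (g : Fin k' → Pol) →
                ∑P (λ j → fibreSum μ h j *P g j) ≈P ∑P (λ l → h l *P g (μ l))
  ∑P-fibreSum {k} {k'} μ h g a b = begin
    coeff (∑P (λ j → fibreSum μ h j *P g j)) a b           ≈⟨ coeff-∑P (λ j → fibreSum μ h j *P g j) a b ⟩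
    sum (λ j → coeff (fibreSum μ h j *P g j) a b)          ≈⟨ sum-cong-≋ (λ j → coeff-∑P-*P (λ l → entry l j) (g j) a b) ⟩
    sum (λ j → sum (λ l → coeff (entry l j *P g j) a b))   ≈⟨ ∑-comm (λ j l → coeff (entry l j *P g j) a b) ⟩
    sum (λ l → sum (λ j → coeff (entry l j *P g j) a b))   ≈⟨ sum-cong-≋ (λ l → trans (sum-single _ (μ l) (off l)) (on l)) ⟩
    sum (λ l → coeff (h l *P g (μ l)) a b)                 ≈⟨ coeff-∑P (λ l → h l *P g (μ l)) a b ⟨
    coeff (∑P (λ l → h l *P g (μ l))) a b                  ∎
    where
    entry : Fin k → Fin k' → Pol
    entry l j = if does (μ l Fin.≟ j) then h l else 0P
    off : ∀ l j → j ≢ μ l → coeff (entry l j *P g j) a b ≈ 0#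
    off l j j≢μl with μ l Fin.≟ j
    ... | yes μl≡j = ⊥-elim (j≢μl (≡.sym μl≡j))
    ... | no  _    = refl
    on : ∀ l → coeff (entry l (μ l) *P g (μ l)) a b ≈ coeff (h l *P g (μ l)) a b
    on l with μ l Fin.≟ μ l
    ... | yes _    = refl
    ... | no  μl≢μl = ⊥-elim (μl≢μl ≡.refl)

module Fractions {c ℓ} (F : CharZeroField c ℓ) (n m : ℕ) where
  open CharZeroField F
  open CommutativeRing cring using (Carrier; _≈_; 0#)
  module K = CommutativeRing cring
  open Poly F n m
  open Polynomials F n m
  open import Relation.Binary.Bundles using (Setoid)
  open Setoid ≈P-setoid using (refl; reflexive)
  open import Data.List as L using ([]; _∷_)
  import Data.List.Properties as Lₚ
  open import Relation.Binary.Reasoning.Setoid ≈P-setoid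

  *P-congʳ : ∀ {p p'} q → p ≈P p' → p *P q ≈P p' *P q
  *P-congʳ {p} {p'} q p≈p' = begin
    p *P q   ≈⟨ *P-comm p q ⟩
    q *P p   ≈⟨ *P-congˡ q p≈p' ⟩
    q *P p'  ≈⟨ *P-comm q p' ⟩
    p' *P q  ∎

  *P-cong : ∀ {p p' q q'} → p ≈P p' → q ≈P q' → p *P q ≈P p' *P q'
  *P-cong {p} {p'} {q} {q'} p≈p' q≈q' = begin
    p *P q   ≈⟨ *P-congʳ {p} {p'} q p≈p' ⟩
    p' *P q  ≈⟨ *P-congˡ p' q≈q' ⟩
    p' *P q' ∎

  *P-identityʳ : ∀ p → p *P 1P ≈P p
  *P-identityʳ p = begin
    p *P 1P  ≈⟨ *P-comm p 1P ⟩
    1P *P p  ≈⟨ *P-identityˡ p ⟩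
    p        ∎

  _^P_ : Pol → ℕ → Pol
  d ^P zero  = 1P
  d ^P suc k = d *P (d ^P k)

  ∑F-common-denominator : ∀ k (G : Fin (suc k) → Frac) d → (∀ i → proj₂ (G i) ≈P d) →
                          proj₁ (∑F G) ≈P ∑P (proj₁ ∘ G) *P (d ^P k) × proj₂ (∑F G) ≈P d ^P suc k
  ∑F-common-denominator zero G d Dᵢ≈d = numerator , *P-congʳ {proj₂ (G Fin.zero)} {d} 1P (Dᵢ≈d Fin.zero)
    where
    A₀ : Pol
    A₀ = proj₁ (G Fin.zero)
    numerator : (A₀ *P 1P) L.++ [] ≈P (A₀ L.++ []) *P 1P
    numerator = reflexive (≡.trans (Lₚ.++-identityʳ _) (≡.cong (_*P 1P) (≡.sym (Lₚ.++-identityʳ A₀))))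
  ∑F-common-denominator (suc k) G d Dᵢ≈d = numerator , denominator
    where
    A₀ D₀ A' D' S' : Pol
    A₀ = proj₁ (G Fin.zero)
    D₀ = proj₂ (G Fin.zero)
    A' = proj₁ (∑F (G ∘ Fin.suc))
    D' = proj₂ (∑F (G ∘ Fin.suc))
    S' = ∑P (proj₁ ∘ G ∘ Fin.suc)
    IH : A' ≈P S' *P (d ^P k) × D' ≈P d ^P suc k
    IH = ∑F-common-denominator k (G ∘ Fin.suc) d (Dᵢ≈d ∘ Fin.suc)
    numerator : (A₀ *P D') +P (A' *P D₀) ≈P (A₀ +P S') *P (d ^P suc k)
    numerator = begin
      (A₀ *P D') +P (A' *P D₀)                         ≈⟨ +P-cong {A₀ *P D'} {A₀ *P (d ^P suc k)} {A' *P D₀} {S' *P (d ^P suc k)}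
                                                            (*P-congˡ A₀ (proj₂ IH)) tail≈ ⟩
      (A₀ *P (d ^P suc k)) +P (S' *P (d ^P suc k))     ≈⟨ *P-distribʳ A₀ S' (d ^P suc k) ⟨
      (A₀ +P S') *P (d ^P suc k)                       ∎
      where
      tail≈ : A' *P D₀ ≈P S' *P (d ^P suc k)
      tail≈ = begin
        A' *P D₀                 ≈⟨ *P-cong {A'} {S' *P (d ^P k)} {D₀} (proj₁ IH) (Dᵢ≈d Fin.zero) ⟩
        (S' *P (d ^P k)) *P d    ≈⟨ *P-assoc S' (d ^P k) d ⟩
        S' *P ((d ^P k) *P d)    ≈⟨ *P-congˡ S' (*P-comm (d ^P k) d) ⟩
        S' *P (d ^P suc k)       ∎
    denominator : D₀ *P D' ≈P d *P (d ^P suc k)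
    denominator = *P-cong {D₀} {d} {D'} (Dᵢ≈d Fin.zero) (proj₂ IH)

  embed-≈F-∑F : ∀ k f (h g : Fin (suc k) → Pol) d → ∑P (λ i → h i *P g i) ≈P f *P d →
                embed f ≈F ∑F (λ i → (h i , d) *F embed (g i))
  embed-≈F-∑F k f h g d ∑hg≈fd = begin
    f *P D                 ≈⟨ *P-congˡ f (proj₂ common) ⟩
    f *P (d ^P suc k)      ≈⟨ *P-assoc f d (d ^P k) ⟨
    (f *P d) *P (d ^P k)   ≈⟨ *P-congʳ {∑P (λ i → h i *P g i)} {f *P d} (d ^P k) ∑hg≈fd ⟨
    ∑P (λ i → h i *P g i) *P (d ^P k) ≈⟨ proj₁ common ⟨
    A                      ≈⟨ *P-identityʳ A ⟨
    A *P 1P                ∎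
    where
    G : Fin (suc k) → Frac
    G i = (h i , d) *F embed (g i)
    A D : Pol
    A = proj₁ (∑F G)
    D = proj₂ (∑F G)
    common : A ≈P ∑P (λ i → h i *P g i) *P (d ^P k) × D ≈P d ^P suc k
    common = ∑F-common-denominator k G d (λ i → *P-identityʳ d)

  κMonomial-valid : ∀ p {x} a₀ → ¬ x ≈ 0# → ValidFrac (p , κMonomial x a₀)
  κMonomial-valid p {x} a₀ x≉0 = inKκ , nonzero
    where
    inKκ : InKκ (κMonomial x a₀)
    inKκ a b b≢0 = K.trans (coeff-singleton _ a b) (termCoeff-miss x a₀ _ a b (b≢0 ∘ proj₂))
    nonzero : ¬ κMonomial x a₀ ≈P 0P
    nonzero x≈0 = x≉0 (K.trans (K.sym (K.trans (coeff-singleton _ a₀ _) (termCoeff-hit x a₀ _))) (x≈0 a₀ _))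

  -- The index set must be nonempty: the sum of the fractions then has a power of the
  -- common denominator as its denominator, and no cancellation in K[κ, x] is needed.
  inIdeal-intro : ∀ {k p} {Allowed : Fin k → Set p} (g : Fin k → Pol) f → Fin k →
                  (h : Fin k → Pol) (x : Carrier) (a₀ : Vec ℕ m) → ¬ x ≈ 0# →
                  (∀ i → ¬ Allowed i → h i ≈P 0P) →
                  ∑P (λ i → h i *P g i) ≈P f *P κMonomial x a₀ → InIdeal g Allowed f
  inIdeal-intro {suc k} g f _ h x a₀ x≉0 h≈0 ∑hg≈fd =
    (λ i → h i , κMonomial x a₀) ,
    (λ i → κMonomial-valid (h i) a₀ x≉0) ,
    (λ i ¬allowed → Setoid.trans ≈P-setoid {h i *P 1P} {h i} {0P} (*P-identityʳ (h i)) (h≈0 i ¬allowed)) ,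
    embed-≈F-∑F k f h g (κMonomial x a₀) ∑hg≈fd

module Reactants where
  open import Data.Vec using ([]; _∷_)
  open import Data.Bool as B using (Bool; true; false)
  open import Data.Empty using (⊥-elim)
  open import Data.Fin.Properties using (any?; all?)
  open import Relation.Nullary using (Dec)
  open import Relation.Nullary.Decidable using (_×-dec_; ¬?; _→-dec_)
  open import Data.Vec.Properties using (≡-dec)

  supportSize : ∀ {k} → Complex k → ℕ
  supportSize []           = 0
  supportSize (true  ∷ ys) = suc (supportSize ys)
  supportSize (false ∷ ys) = supportSize ys

  _∣C?_ : ∀ {k} (y z : Complex k) → Dec (y ∣C z)
  y ∣C? z = all? (λ s → (lookup y s B.≟ true) →-dec (lookup z s B.≟ true))

  nonzero⇒species : ∀ {k} (y : Complex k) → y ≢ zeroComplex → Fin k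
  nonzero⇒species {zero}  [] y≢0 = ⊥-elim (y≢0 ≡.refl)
  nonzero⇒species {suc k} _  _   = Fin.zero

  ∣C-trans : ∀ {k} {x y z : Complex k} → x ∣C y → y ∣C z → x ∣C z
  ∣C-trans x∣y y∣z s xₛ = y∣z s (x∣y s xₛ)

  ∣C⇒supportSize-≤ : ∀ {k} (y z : Complex k) → y ∣C z → supportSize y ≤ supportSize z
  ∣C⇒supportSize-≤ []           []           _   = z≤n
  ∣C⇒supportSize-≤ (true  ∷ ys) (z ∷ zs)     y∣z with y∣z Fin.zero ≡.refl
  ... | ≡.refl = s≤s (∣C⇒supportSize-≤ ys zs (y∣z ∘ Fin.suc))
  ∣C⇒supportSize-≤ (false ∷ ys) (true  ∷ zs) y∣z = ℕₚ.m≤n⇒m≤1+n (∣C⇒supportSize-≤ ys zs (y∣z ∘ Fin.suc))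
  ∣C⇒supportSize-≤ (false ∷ ys) (false ∷ zs) y∣z = ∣C⇒supportSize-≤ ys zs (y∣z ∘ Fin.suc)

  ∣C-≢⇒supportSize-< : ∀ {k} (y z : Complex k) → y ∣C z → y ≢ z → supportSize y < supportSize z
  ∣C-≢⇒supportSize-< []           []           _   y≢z = ⊥-elim (y≢z ≡.refl)
  ∣C-≢⇒supportSize-< (true  ∷ ys) (z ∷ zs)     y∣z y≢z with y∣z Fin.zero ≡.refl
  ... | ≡.refl = s≤s (∣C-≢⇒supportSize-< ys zs (y∣z ∘ Fin.suc) (y≢z ∘ ≡.cong (true ∷_)))
  ∣C-≢⇒supportSize-< (false ∷ ys) (true  ∷ zs) y∣z y≢z = s≤s (∣C⇒supportSize-≤ ys zs (y∣z ∘ Fin.suc))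
  ∣C-≢⇒supportSize-< (false ∷ ys) (false ∷ zs) y∣z y≢z =
    ∣C-≢⇒supportSize-< ys zs (y∣z ∘ Fin.suc) (y≢z ∘ ≡.cong (false ∷_))

  module _ {n m : ℕ} (N : Network n m) where
    open Network N

    minimalReactantBelow : ∀ l → ∃[ j ] IsMinimalReactant N (reactant j) × reactant j ∣C reactant l
    minimalReactantBelow l = descend (suc (supportSize (reactant l))) l ℕₚ.≤-refl
      where
      -- the support size strictly decreases along proper divisors, so it bounds the descent
      descend : ∀ bound l → supportSize (reactant l) < bound →
                ∃[ j ] IsMinimalReactant N (reactant j) × reactant j ∣C reactant l
      descend (suc bound) l (s≤s size≤bound)
        with any? (λ j → (reactant j ∣C? reactant l) ×-dec ¬? (≡-dec B._≟_ (reactant j) (reactant l)))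
      ... | yes (j , j∣l , j≢l) with descend bound j (ℕₚ.<-≤-trans (∣C-≢⇒supportSize-< _ _ j∣l j≢l) size≤bound)
      ...   | (j' , minimal , j'∣j) = j' , minimal , ∣C-trans {x = reactant j'} {reactant j} {reactant l} j'∣j j∣l
      descend (suc bound) l _ | no noProperDivisor = l , ((l , ≡.refl) , minimal) , (λ s yₛ → yₛ)
        where
        minimal : ∀ j → reactant j ∣C reactant l → reactant j ≡ reactant l
        minimal j j∣l with ≡-dec B._≟_ (reactant j) (reactant l)
        ... | yes j≡l = j≡l
        ... | no  j≢l = ⊥-elim (noProperDivisor (j , j∣l , j≢l))

  map-∸-+ᵛ : ∀ {k} (f : Bool → ℕ) → f false ≡ 0 → (y z : Complex k) → y ∣C z →
             V.zipWith _∸_ (V.map f z) (V.map f y) ExponentVectors.+ᵛ V.map f y ≡ V.map f z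
  map-∸-+ᵛ f f0 []           []       _   = ≡.refl
  map-∸-+ᵛ f f0 (true  ∷ ys) (z ∷ zs) y∣z with y∣z Fin.zero ≡.refl
  ... | ≡.refl = ≡.cong₂ _∷_ (ℕₚ.m∸n+n≡m (ℕₚ.≤-refl {f true})) (map-∸-+ᵛ f f0 ys zs (y∣z ∘ Fin.suc))
  map-∸-+ᵛ f f0 (false ∷ ys) (z ∷ zs) y∣z rewrite f0 =
    ≡.cong₂ _∷_ (ℕₚ.+-identityʳ (f z)) (map-∸-+ᵛ f f0 ys zs (y∣z ∘ Fin.suc))

module MinimalReactantIdeal {c ℓ} (F : CharZeroField c ℓ) (n m : ℕ) (N : Network n m) where
  open CharZeroField F
  open CommutativeRing cring
  open Poly F n m
  open Polynomials F n m
  open Fractions F n m using (*P-identityʳ; inIdeal-intro)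
  open import Data.List using ([]; _∷_)
  open Network N
  open Reactants
  open import Relation.Binary.Reasoning.Setoid ≈P-setoid

  μ : Fin m → Fin m
  μ l = proj₁ (minimalReactantBelow N l)

  μ-minimal : ∀ l → IsMinimalReactant N (reactant (μ l))
  μ-minimal l = proj₁ (proj₂ (minimalReactantBelow N l))

  exponentGap : Fin m → Vec ℕ n
  exponentGap l = V.zipWith _∸_ (boolExp (reactant l)) (boolExp (reactant (μ l)))

  quotientTerm : Fin n → Fin m → Term
  quotientTerm s l = term (intK (stoich N l s)) (unitExp l) (exponentGap l)

  μ-divides : ∀ l → reactant (μ l) ∣C reactant l
  μ-divides l = proj₂ (proj₂ (minimalReactantBelow N l))

  quotientTerm-*P : ∀ s l → (quotientTerm s l ∷ []) *P xMon (reactant (μ l))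
                            ≈P term (intK (stoich N l s)) (unitExp l) (boolExp (reactant l)) ∷ []
  quotientTerm-*P s l a b =
    trans (coeff-singleton _ a b)
          (trans (termCoeff-cong-≡ (*-identityʳ _) (Vₚ.zipWith-identityʳ ℕₚ.+-identityʳ (unitExp l))
                                   (map-∸-+ᵛ _ ≡.refl (reactant (μ l)) (reactant l) (μ-divides l)) a b)
                 (sym (coeff-singleton _ a b)))

  cofactor : Fin n → Fin m → Pol
  cofactor s = fibreSum μ (λ l → quotientTerm s l ∷ [])

  xdot-decomposition : ∀ s → ∑P (λ j → cofactor s j *P xMon (reactant j)) ≈P xdot N s *P 1P
  xdot-decomposition s = begin
    ∑P (λ j → cofactor s j *P xMon (reactant j))                      ≈⟨ ∑P-fibreSum μ _ (λ j → xMon (reactant j)) ⟩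
    ∑P (λ l → (quotientTerm s l ∷ []) *P xMon (reactant (μ l)))        ≈⟨ ∑P-cong (quotientTerm-*P s) ⟩
    xdot N s                                                          ≈⟨ *P-identityʳ (xdot N s) ⟨
    xdot N s *P 1P                                                    ∎

  cofactor-nonminimal : ∀ s j → ¬ IsMinimalReactant N (reactant j) → cofactor s j ≈P 0P
  cofactor-nonminimal s j nonminimal = fibreSum-outside-image μ _ j
    (λ l μl≡j → nonminimal (≡.subst (IsMinimalReactant N ∘ reactant) μl≡j (μ-minimal l)))

  xdot∈minimalReactantIdeal : ∀ s → InIdeal (xMon ∘ reactant) (IsMinimalReactant N ∘ reactant) (xdot N s)
  xdot∈minimalReactantIdeal s =
    inIdeal-intro (xMon ∘ reactant) (xdot N s) (proj₁ (covering s)) (cofactor s) 1# (V.replicate m 0) 1≉0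
                  (cofactor-nonminimal s) (xdot-decomposition s)

imbalance-transfer : ∀ {yr yb xr xb mr mb ku kv} →
                     yr ℕ.+ mr ≡ (yb ℕ.+ mb) ℕ.+ ku → xr ℕ.+ mr ≡ (xb ℕ.+ mb) ℕ.+ kv →
                     (xr ℕ.+ yb) ℕ.+ ku ≡ (yr ℕ.+ xb) ℕ.+ kv
imbalance-transfer {yr} {yb} {xr} {xb} {mr} {mb} {ku} {kv} eᵤ eᵥ = ℕₚ.+-cancelʳ-≡ (mr + mb) _ _ (begin
  ((xr + yb) + ku) + (mr + mb)   ≡⟨ solve (xr ∷ yb ∷ ku ∷ mr ∷ mb ∷ []) ⟩
  (xr + mr) + ((yb + mb) + ku)   ≡⟨ ≡.cong₂ _+_ eᵥ (≡.sym eᵤ) ⟩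
  ((xb + mb) + kv) + (yr + mr)   ≡⟨ solve (yr ∷ xb ∷ kv ∷ mr ∷ mb ∷ []) ⟩
  ((yr + xb) + kv) + (mr + mb)   ∎)
  where
  open import Data.Nat using (_+_)
  open import Data.Nat.Tactic.RingSolver using (solve)
  open import Data.List using ([]; _∷_)
  open ≡.≡-Reasoning

module HypergraphDegrees {n m : ℕ} (N : Network n m) where
  open Network N

  speciesDeg : Multiset N → Complex n → ℕ
  speciesDeg E y = ∑ N (λ s → E (speciesEdge s) ℕ.* b2n N (lookup y s))

  reactionDeg : Multiset N → Fin m → ℕ
  reactionDeg E l = ∑ N (λ j → E (reactionEdge j) ℕ.* inc N (u l) (reactionEdge j))

  inc-u≡inc-v : ∀ l j → inc N (u l) (reactionEdge j) ≡ inc N (v l) (reactionEdge j)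
  inc-u≡inc-v l j with l Fin.≟ j
  ... | yes _ = ≡.refl
  ... | no  _ = ≡.refl

  deg-v : ∀ E l → deg N E (v l) ≡ speciesDeg E (product l) ℕ.+ reactionDeg E l
  deg-v E l = ≡.cong (λ r → speciesDeg E (product l) ℕ.+ V.sum r)
    (Vₚ.tabulate-cong (λ j → ≡.cong (E (reactionEdge j) ℕ.*_) (≡.sym (inc-u≡inc-v l j))))

  u-injective : ∀ {l i} → _≡_ {A = Vertex N} (u l) (u i) → l ≡ i
  u-injective ≡.refl = ≡.refl

  v-injective : ∀ {l i} → _≡_ {A = Vertex N} (v l) (v i) → l ≡ i
  v-injective ≡.refl = ≡.refl

module SteadyStateIdeal {c ℓ} (F : CharZeroField c ℓ) (n m : ℕ) (N : Network n m) where
  open CharZeroField F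
  open CommutativeRing cring
  open Poly F n m
  open RingFacts cring
  open Polynomials F n m
  open Fractions F n m using (inIdeal-intro)
  open Network N
  open HypergraphDegrees N
  open import Data.List using ([]; _∷_)
  open import Level using (_⊔_)
  open import Data.Bool using (true; false)
  open import Data.Integer as ℤ using (+_)
  open import Data.Sum using (inj₁; inj₂)
  open import Data.Unit using (tt)
  open import Data.Empty using (⊥-elim)
  open import Algebra.Properties.Ring ring using (-0#≈0#; x∙y⁻¹≈ε⇒x≈y)
  open import Relation.Binary.Reasoning.Setoid setoid

  column : (Fin n → Carrier) → Fin m → Carrier
  column w l = sum (λ s → w s * intK (stoich N l s))

  weight : Multiset N → Multiset N → Fin n → Carrier
  weight Er Eb s = natK cring (Er (speciesEdge s)) - natK cring (Eb (speciesEdge s))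

  intK-b2n-diff : ∀ p q → intK (+ b2n N p ℤ.- + b2n N q) ≈ natK cring (b2n N p) - natK cring (b2n N q)
  intK-b2n-diff true  true  = sym (-‿inverseʳ _)
  intK-b2n-diff true  false = sym (trans (+-congˡ -0#≈0#) (+-identityʳ _))
  intK-b2n-diff false true  = sym (+-identityˡ _)
  intK-b2n-diff false false = sym (-‿inverseʳ 0#)

  natK-speciesDeg : ∀ E y → natK cring (speciesDeg E y)
                            ≈ sum (λ s → natK cring (E (speciesEdge s)) * natK cring (b2n N (lookup y s)))
  natK-speciesDeg E y = trans (natK-sum (λ s → E (speciesEdge s) ℕ.* b2n N (lookup y s)))
                              (sum-cong-≋ (λ s → natK-* (E (speciesEdge s)) (b2n N (lookup y s))))

  column-weight : ∀ Er Eb l →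
    column (weight Er Eb) l ≈ natK cring (speciesDeg Er (product l) ℕ.+ speciesDeg Eb (reactant l))
                              - natK cring (speciesDeg Er (reactant l) ℕ.+ speciesDeg Eb (product l))
  column-weight Er Eb l = begin
    sum (λ s → weight Er Eb s * intK (stoich N l s))
      ≈⟨ sum-cong-≋ (λ s → *-congˡ (intK-b2n-diff (lookup (product l) s) (lookup (reactant l) s))) ⟩
    sum (λ s → (R s - B s) * (P s - Q s))
      ≈⟨ sum-cong-≋ (λ s → expand-diff-* (R s) (B s) (P s) (Q s)) ⟩
    sum (λ s → (R s * P s + B s * Q s) - (R s * Q s + B s * P s))
      ≈⟨ ∑-distrib-‿ (λ s → R s * P s + B s * Q s) (λ s → R s * Q s + B s * P s) ⟩
    sum (λ s → R s * P s + B s * Q s) - sum (λ s → R s * Q s + B s * P s)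
      ≈⟨ -‿cong₂ (∑-distrib-+ (λ s → R s * P s) (λ s → B s * Q s)) (∑-distrib-+ (λ s → R s * Q s) (λ s → B s * P s)) ⟩
    (sum (λ s → R s * P s) + sum (λ s → B s * Q s)) - (sum (λ s → R s * Q s) + sum (λ s → B s * P s))
      ≈⟨ -‿cong₂ (+-cong (natK-speciesDeg Er (product l)) (natK-speciesDeg Eb (reactant l)))
                 (+-cong (natK-speciesDeg Er (reactant l)) (natK-speciesDeg Eb (product l))) ⟨
    (natK cring (speciesDeg Er (product l)) + natK cring (speciesDeg Eb (reactant l)))
      - (natK cring (speciesDeg Er (reactant l)) + natK cring (speciesDeg Eb (product l)))
      ≈⟨ -‿cong₂ (natK-+ (speciesDeg Er (product l)) (speciesDeg Eb (reactant l)))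
                 (natK-+ (speciesDeg Er (reactant l)) (speciesDeg Eb (product l))) ⟨
    natK cring (speciesDeg Er (product l) ℕ.+ speciesDeg Eb (reactant l))
      - natK cring (speciesDeg Er (reactant l) ℕ.+ speciesDeg Eb (product l)) ∎
    where
    R B P Q : Fin n → Carrier
    R s = natK cring (Er (speciesEdge s))
    B s = natK cring (Eb (speciesEdge s))
    P s = natK cring (b2n N (lookup (product l) s))
    Q s = natK cring (b2n N (lookup (reactant l) s))

  column-weight-imbalance : ∀ Er Eb l {ku kv} →
    deg N Er (u l) ≡ deg N Eb (u l) ℕ.+ ku → deg N Er (v l) ≡ deg N Eb (v l) ℕ.+ kv →
    column (weight Er Eb) l ≈ natK cring kv - natK cring ku
  column-weight-imbalance Er Eb l {ku} {kv} excessᵤ excessᵥ =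
    trans (column-weight Er Eb l)
          (diff-swap (trans (sym (natK-+ gain ku)) (trans (reflexive (≡.cong (natK cring) transfer)) (natK-+ loss kv))))
    where
    gain loss : ℕ
    gain = speciesDeg Er (product l) ℕ.+ speciesDeg Eb (reactant l)
    loss = speciesDeg Er (reactant l) ℕ.+ speciesDeg Eb (product l)
    transfer : gain ℕ.+ ku ≡ loss ℕ.+ kv
    transfer = imbalance-transfer {speciesDeg Er (reactant l)} {speciesDeg Eb (reactant l)}
                                  {speciesDeg Er (product l)} {speciesDeg Eb (product l)}
                                  {reactionDeg Er l} {reactionDeg Eb l}
                                  excessᵤ (≡.trans (≡.sym (deg-v Er l)) (≡.trans excessᵥ (≡.cong (ℕ._+ kv) (deg-v Eb l))))

  column-weight-balanced : ∀ Er Eb l →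
    deg N Er (u l) ≡ deg N Eb (u l) → deg N Er (v l) ≡ deg N Eb (v l) → column (weight Er Eb) l ≈ 0#
  column-weight-balanced Er Eb l balancedᵤ balancedᵥ =
    trans (column-weight-imbalance Er Eb l (+0 balancedᵤ) (+0 balancedᵥ)) (-‿inverseʳ 0#)
    where
    +0 : ∀ {x y} → x ≡ y → x ≡ y ℕ.+ 0
    +0 x≡y = ≡.trans x≡y (≡.sym (ℕₚ.+-identityʳ _))

  record SeparatingWeights (i : Fin m) : Set (c ⊔ ℓ) where
    field
      weights  : Fin n → Carrier
      pivot    : Carrier
      pivot≉0  : ¬ pivot ≈ 0#
      column-≢ : ∀ l → l ≢ i → column weights l ≈ 0#
      column-≡ : column weights i ≈ pivot

  almostBalanced⇒separatingWeights : ∀ i → AlmostBalanced N (u i) ⊎ AlmostBalanced N (v i) → SeparatingWeights i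
  almostBalanced⇒separatingWeights i (inj₁ (_ , _ , zero , () , _))
  almostBalanced⇒separatingWeights i (inj₁ (Er , Eb , suc k , _ , excess , balanced)) = record
    { weights  = weight Er Eb
    ; pivot    = natK cring 0 - natK cring (suc k)
    ; pivot≉0  = λ pivot≈0 → charZero k (sym (x∙y⁻¹≈ε⇒x≈y _ _ pivot≈0))
    ; column-≢ = λ l l≢i → column-weight-balanced Er Eb l (balanced (u l) (l≢i ∘ u-injective)) (balanced (v l) λ ())
    ; column-≡ = column-weight-imbalance Er Eb i excess (≡.trans (balanced (v i) λ ()) (≡.sym (ℕₚ.+-identityʳ _)))
    }
  almostBalanced⇒separatingWeights i (inj₂ (_ , _ , zero , () , _))
  almostBalanced⇒separatingWeights i (inj₂ (Er , Eb , suc k , _ , excess , balanced)) = record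
    { weights  = weight Er Eb
    ; pivot    = natK cring (suc k) - natK cring 0
    ; pivot≉0  = λ pivot≈0 → charZero k (x∙y⁻¹≈ε⇒x≈y _ _ pivot≈0)
    ; column-≢ = λ l l≢i → column-weight-balanced Er Eb l (balanced (u l) λ ()) (balanced (v l) (l≢i ∘ v-injective))
    ; column-≡ = column-weight-imbalance Er Eb i (≡.trans (balanced (u i) λ ()) (≡.sym (ℕₚ.+-identityʳ _))) excess
    }

  weighted-xdot : ∀ {i} (W : SeparatingWeights i) → let open SeparatingWeights W in
    ∑P (λ s → κMonomial (weights s) (V.replicate m 0) *P xdot N s) ≈P xMon (reactant i) *P κMonomial pivot (unitExp i)
  weighted-xdot {i} W a b = begin
    coeff (∑P (λ s → κMonomial (w s) 0ᵐ *P xdot N s)) a b   ≈⟨ coeff-∑P (λ s → κMonomial (w s) 0ᵐ *P xdot N s) a b ⟩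
    sum (λ s → coeff (κMonomial (w s) 0ᵐ *P xdot N s) a b)  ≈⟨ sum-cong-≋ (λ s → constant-*P (w s) (xdot N s) a b) ⟩
    sum (λ s → w s * coeff (xdot N s) a b)                   ≈⟨ sum-cong-≋ (λ s → *-congˡ (coeff-xdot s)) ⟩
    sum (λ s → w s * sum (λ l → σ l s * I l))                ≈⟨ sum-cong-≋ (λ s → *-distribˡ-sum (w s) (λ l → σ l s * I l)) ⟩
    sum (λ s → sum (λ l → w s * (σ l s * I l)))              ≈⟨ ∑-comm (λ s l → w s * (σ l s * I l)) ⟩
    sum (λ l → sum (λ s → w s * (σ l s * I l)))              ≈⟨ sum-cong-≋ column-times ⟩
    sum (λ l → column w l * I l)                             ≈⟨ sum-single (λ l → column w l * I l) i
                                                                  (λ l l≢i → trans (*-congʳ (column-≢ l l≢i)) (zeroˡ _)) ⟩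
    column w i * I i                                         ≈⟨ *-congʳ column-≡ ⟩
    pivot * I i                                              ≈⟨ termCoeff-scale pivot (unitExp i) yᵢ a b ⟨
    termCoeff (term pivot (unitExp i) yᵢ) a b                ≈⟨ termCoeff-cong-≡ (*-identityˡ pivot)
                                                                  (Vₚ.zipWith-identityˡ ℕₚ.+-identityˡ (unitExp i))
                                                                  (Vₚ.zipWith-identityʳ ℕₚ.+-identityʳ yᵢ) a b ⟨
    termCoeff (mulT (term 1# 0ᵐ yᵢ) (term pivot (unitExp i) (V.replicate n 0))) a b ≈⟨ coeff-singleton _ a b ⟨
    coeff (xMon (reactant i) *P κMonomial pivot (unitExp i)) a b ∎
    where
    open SeparatingWeights W renaming (weights to w)
    0ᵐ : Vec ℕ m
    0ᵐ = V.replicate m 0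
    yᵢ : Vec ℕ n
    yᵢ = boolExp (reactant i)
    σ : Fin m → Fin n → Carrier
    σ l s = intK (stoich N l s)
    I : Fin m → Carrier
    I l = termCoeff (term 1# (unitExp l) (boolExp (reactant l))) a b
    coeff-xdot : ∀ s → coeff (xdot N s) a b ≈ sum (λ l → σ l s * I l)
    coeff-xdot s = trans (coeff-∑P (λ l → xdotTerm l ∷ []) a b)
                         (sum-cong-≋ (λ l → trans (coeff-singleton (xdotTerm l) a b)
                                                  (termCoeff-scale (σ l s) (unitExp l) (boolExp (reactant l)) a b)))
      where
      xdotTerm : Fin m → Term
      xdotTerm l = term (σ l s) (unitExp l) (boolExp (reactant l))
    column-times : ∀ l → sum (λ s → w s * (σ l s * I l)) ≈ column w l * I l
    column-times l = trans (sum-cong-≋ (λ s → sym (*-assoc (w s) (σ l s) (I l)))) (sym (*-distribʳ-sum (I l) (λ s → w s * σ l s)))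

  xMon∈steadyStateIdeal : ∀ i → AlmostBalanced N (u i) ⊎ AlmostBalanced N (v i) →
                          InIdeal (xdot N) (λ _ → ⊤) (xMon (reactant i))
  xMon∈steadyStateIdeal i almostBalanced =
    inIdeal-intro (xdot N) (xMon (reactant i)) (Reactants.nonzero⇒species (reactant i) (noInflow i))
                  (λ s → κMonomial (weights s) (V.replicate m 0)) pivot (unitExp i) pivot≉0
                  (λ _ ¬⊤ → ⊥-elim (¬⊤ tt)) (weighted-xdot W)
    where
    W : SeparatingWeights i
    W = almostBalanced⇒separatingWeights i almostBalanced
    open SeparatingWeights W

theorem3p12 : ∀ {c ℓ} (F : CharZeroField c ℓ) (n m : ℕ) (N : Network n m) →
    (∀ y → IsMinimalReactant N y →
      ∃[ j ] (Network.reactant N j ≡ y ×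
               (AlmostBalanced N (u j) ⊎ AlmostBalanced N (v j)))) →
    (∀ s → Poly.InIdeal F n m (λ j → Poly.xMon F n m (Network.reactant N j))
                             (λ j → IsMinimalReactant N (Network.reactant N j))
                             (Poly.xdot F n m N s))
    × (∀ j → IsMinimalReactant N (Network.reactant N j) →
         Poly.InIdeal F n m (Poly.xdot F n m N) (λ _ → ⊤) (Poly.xMon F n m (Network.reactant N j)))
theorem3p12 F n m N minimalReactantsAlmostBalanced =
  MinimalReactantIdeal.xdot∈minimalReactantIdeal F n m N , xMon∈steadyStateIdeal
  where
  open Network N using (reactant)
  xMon∈steadyStateIdeal : ∀ j → IsMinimalReactant N (reactant j) →
                          Poly.InIdeal F n m (Poly.xdot F n m N) (λ _ → ⊤) (Poly.xMon F n m (reactant j))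
  xMon∈steadyStateIdeal j minimal with minimalReactantsAlmostBalanced (reactant j) minimal
  ... | i , yᵢ≡yⱼ , almostBalanced =
    ≡.subst (Poly.InIdeal F n m (Poly.xdot F n m N) (λ _ → ⊤) ∘ Poly.xMon F n m) yᵢ≡yⱼ
            (SteadyStateIdeal.xMon∈steadyStateIdeal F n m N i almostBalanced)
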